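{- For all $e \in \mathbb{RE}(\Gamma)$, $e \equiv \hat{e}$.
   Context: Fix countably infinite disjoint alphabets $\Sigma$ (atomic actions) and $\Pi$ (atomic propositions). The set $\mathbb{E}$ of expressions is given by $e,f ::= \mathtt{a}\in\Sigma \mid \mathtt{p}\in\Pi \mid \mathtt{0} \mid \mathtt{1} \mid e+f \mid e\cdot f \mid e^{\bot} \mid e^{\top} \mid e^{*}$ ($^{\bot}$ antidomain, $^{\top}$ domain). $\equiv$ is the smallest congruence on $\mathbb{E}$ satisfying the Kleene algebra axioms (idempotent semiring laws, $\mathtt{1}+e\cdot e^{*}\leqq e^{*}$, $\mathtt{1}+e^{*}\cdot e\leqq e^{*}$, $f+e\cdot g\leqq g \Rightarrow e^{*}\cdot f\leqq g$, $f+g\cdot e\leqq g\Rightarrow f\cdot e^{*}\leqq g$) together with $e^{\bot}\cdot e\equiv\mathtt{0}$, $(e\cdot f)^{\bot}\equiv(e\cdot f^{\top})^{\bot}$, $e^{\bot}+e^{\top}\equiv\mathtt{1}$, $\mathtt{p}^{\top}\equiv\mathtt{p}$, $e^{\top}\equiv e^{\bot\bot}$; $e\leqq f$ means $e+f\equiv f$. A test is $e^{\top}$ with $e$ containing no $^{\top}$; a parameter is a test or element of $\Pi$. Fix a finite set of parameters $\Gamma$, ordered as $\phi_1,\dots,\phi_n$. An atom is $\psi_1\cdots\psi_n$ with $\psi_i\in\{\phi_i,\phi_i^{\bot}\}$ (identified with the product expression); consistent iff $G\not\equiv\mathtt{0}$; $\mathbb{C}(\Gamma)$ = consistent atoms;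 $\mathbb{CS}(\Gamma)$ = strings $G_1\mathtt{a}_1\cdots\mathtt{a}_{n-1}G_n$, $G_i\in\mathbb{C}(\Gamma)$, $\mathtt{a}_j\in\Sigma$. The canonical $\Gamma$-interpretation satisfies $[\![ \mathtt{a} ]\!]_{\Gamma}=\{G\mathtt{a}H\in\mathbb{CS}(\Gamma)\mid G\mathtt{a}H\not\equiv\mathtt{0}\}$ for $\mathtt{a}\in\Sigma$. For a formula $\phi$, $\mathbb{C}(\phi):=\sum\{G\in\mathbb{C}(\Gamma)\mid G\leqq\phi\}$. $\mathbb{RE}(\Gamma)$ is the set of regular expressions over $\Sigma\cup\Gamma$ (built from $\Sigma\cup\Gamma$, $\mathtt{0},\mathtt{1}$ with $+,\cdot,^{*}$), and $\mathbb{RE}(\Gamma^{\pm})$ those over $\Sigma\cup\Gamma\cup\{\phi^{\bot}\mid\phi\in\Gamma\}$. The map $\hat{\ }:\mathbb{RE}(\Gamma)\to\mathbb{RE}(\Gamma^{\pm})$ is the smallest function with $\hat{\phi}=\mathbb{C}(\phi)$ ($\phi\in\Gamma$), $\hat{\mathtt{a}}=\sum[\![ \mathtt{a} ]\!]_{\Gamma}$ ($\mathtt{a}\in\Sigma$), $\hat{\mathtt{1}}=\sum\mathbb{C}(\Gamma)$, commuting with $\mathtt{0}$, $\cdot$, $+$ and $^{*}$. -}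

module Defs where

open import Data.Nat using (ℕ)
open import Data.List using (List; []; _∷_; _++_; map; foldr; filter; concatMap)
open import Data.List.Membership.Propositional using (_∈_)
open import Data.List.Relation.Unary.All using (All)
open import Data.Product using (_×_)
open import Relation.Nullary using (¬_; Dec; ¬?)

infixl 6 _+_
infixl 7 _·_
infix 4 _≐_ _≦_

-- Expressions.  Σ (atomic actions) and Π (atomic propositions) are both
-- represented by ℕ, kept disjoint by using different constructors.
data Expr : Set where
  act  : ℕ → Expr
  prop : ℕ → Expr
  𝟘 𝟙  : Expr
  _+_  : Expr → Expr → Expr
  _·_  : Expr → Expr → Expr
  _⊥   : Expr → Expr       -- antidomain  e^⊥
  _⊤   : Expr → Expr       -- domain      e^⊤
  _*   : Expr → Expr

-- The congruence ≡ (written _≐_), together with  e ≦ f  :=  e + f ≐ f.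
mutual
  _≦_ : Expr → Expr → Set
  e ≦ f = e + f ≐ f

  data _≐_ : Expr → Expr → Set where
    ≐-refl  : ∀ {e} → e ≐ e
    ≐-sym   : ∀ {e f} → e ≐ f → f ≐ e
    ≐-trans : ∀ {e f g} → e ≐ f → f ≐ g → e ≐ g
    +-cong  : ∀ {e e' f f'} → e ≐ e' → f ≐ f' → e + f ≐ e' + f'
    ·-cong  : ∀ {e e' f f'} → e ≐ e' → f ≐ f' → e · f ≐ e' · f'
    ⊥-cong  : ∀ {e e'} → e ≐ e' → e ⊥ ≐ e' ⊥
    ⊤-cong  : ∀ {e e'} → e ≐ e' → e ⊤ ≐ e' ⊤
    *-cong  : ∀ {e e'} → e ≐ e' → e * ≐ e' *
    +-assoc : ∀ e f g → (e + f) + g ≐ e + (f + g)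
    +-comm  : ∀ e f → e + f ≐ f + e
    +-idem  : ∀ e → e + e ≐ e
    +-idˡ   : ∀ e → 𝟘 + e ≐ e
    ·-assoc : ∀ e f g → (e · f) · g ≐ e · (f · g)
    ·-idˡ   : ∀ e → 𝟙 · e ≐ e
    ·-idʳ   : ∀ e → e · 𝟙 ≐ e
    distribˡ : ∀ e f g → e · (f + g) ≐ e · f + e · g
    distribʳ : ∀ e f g → (f + g) · e ≐ f · e + g · e
    zeroˡ   : ∀ e → 𝟘 · e ≐ 𝟘
    zeroʳ   : ∀ e → e · 𝟘 ≐ 𝟘
    *-unfoldˡ : ∀ e → 𝟙 + e · (e *) ≦ e *
    *-unfoldʳ : ∀ e → 𝟙 + (e *) · e ≦ e *
    *-indˡ  : ∀ {e f g} → f + e · g ≦ g → (e *) · f ≦ g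
    *-indʳ  : ∀ {e f g} → f + g · e ≦ g → f · (e *) ≦ g
    ad-annih : ∀ e → (e ⊥) · e ≐ 𝟘
    ad-local : ∀ e f → (e · f) ⊥ ≐ (e · (f ⊤)) ⊥
    ad-compl : ∀ e → (e ⊥) + (e ⊤) ≐ 𝟙
    prop-dom : ∀ p → (prop p) ⊤ ≐ prop p
    dom-def  : ∀ e → e ⊤ ≐ (e ⊥) ⊥

data NoDom : Expr → Set where
  act  : ∀ a → NoDom (act a)
  prop : ∀ p → NoDom (prop p)
  𝟘    : NoDom 𝟘
  𝟙    : NoDom 𝟙
  _+_  : ∀ {e f} → NoDom e → NoDom f → NoDom (e + f)
  _·_  : ∀ {e f} → NoDom e → NoDom f → NoDom (e · f)
  _⊥   : ∀ {e} → NoDom e → NoDom (e ⊥)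
  _*   : ∀ {e} → NoDom e → NoDom (e *)

data IsTest : Expr → Set where
  test : ∀ {e} → NoDom e → IsTest (e ⊤)

data IsParam : Expr → Set where
  param-test : ∀ {e} → IsTest e → IsParam e
  param-prop : ∀ p → IsParam (prop p)

prod : List Expr → Expr
prod []       = 𝟙
prod (x ∷ []) = x
prod (x ∷ xs) = x · prod xs

sum : List Expr → Expr
sum = foldr _+_ 𝟘

atomLists : List Expr → List (List Expr)
atomLists []      = [] ∷ []
atomLists (φ ∷ Γ) = map (φ ∷_) (atomLists Γ) ++ map ((φ ⊥) ∷_) (atomLists Γ)

atoms : List Expr → List Expr
atoms Γ = map prod (atomLists Γ)

-- A decision oracle for ≐ (exists classically); used to form the finite
-- sums over the (finite) sets defined by ≢ 𝟘 and ≦.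
Oracle : Set
Oracle = (e f : Expr) → Dec (e ≐ f)

module _ (dec : Oracle) (Γ : List Expr) where

  consAtoms : List Expr
  consAtoms = filter (λ G → ¬? (dec G 𝟘)) (atoms Γ)

  ℂ : Expr → Expr
  ℂ φ = sum (filter (λ G → dec (G + φ) φ) consAtoms)

  strings : ℕ → List Expr
  strings a = concatMap (λ G → map (λ H → G · act a · H) consAtoms) consAtoms

  ⟦_⟧ : ℕ → List Expr
  ⟦ a ⟧ = filter (λ s → ¬? (dec s 𝟘)) (strings a)

data RE (Γ : List Expr) : Set where
  sym  : ℕ → RE Γ
  par  : (φ : Expr) → φ ∈ Γ → RE Γ
  𝟘 𝟙  : RE Γ
  _+_  : RE Γ → RE Γ → RE Γ
  _·_  : RE Γ → RE Γ → RE Γ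
  _*   : RE Γ → RE Γ

⌜_⌝ : ∀ {Γ} → RE Γ → Expr
⌜ sym a ⌝   = act a
⌜ par φ _ ⌝ = φ
⌜ 𝟘 ⌝       = 𝟘
⌜ 𝟙 ⌝       = 𝟙
⌜ e + f ⌝   = ⌜ e ⌝ + ⌜ f ⌝
⌜ e · f ⌝   = ⌜ e ⌝ · ⌜ f ⌝
⌜ e * ⌝     = ⌜ e ⌝ *

hat : Oracle → (Γ : List Expr) → RE Γ → Expr
hat dec Γ (sym a)   = sum (⟦_⟧ dec Γ a)
hat dec Γ (par φ _) = ℂ dec Γ φ
hat dec Γ 𝟘         = 𝟘
hat dec Γ 𝟙         = sum (consAtoms dec Γ)
hat dec Γ (e + f)   = hat dec Γ e + hat dec Γ f
hat dec Γ (e · f)   = hat dec Γ e · hat dec Γ f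
hat dec Γ (e *)     = hat dec Γ e *

-- Parameters are tests, i.e. antidomain elements, and these form a Boolean
-- algebra.  The consistent atoms therefore sum to 𝟙 (an inconsistent atom is 𝟘),
-- and every atom lies below either φ or φ ⊥; multiplying φ ≐ φ · 𝟙 out over this
-- sum keeps exactly the atoms below φ, giving φ ≐ ℂ(φ), and sandwiching an
-- action between two copies of 𝟙 gives a ≐ Σ⟦ a ⟧.  The hat map commutes with
-- the remaining constructors, so e ≐ ê follows by structural induction.
module Submission where

open import Defs
open import Data.List using (List; []; _∷_; _++_; map; filter; concatMap)
open import Data.List.Properties using (map-++)
open import Data.List.Relation.Unary.All using (All; []; _∷_; tabulate)
import Data.List.Relation.Unary.All as All
open import Data.List.Relation.Unary.All.Properties using (map⁺; filter⁺)
open import Data.List.Relation.Unary.Any using (here; there)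
open import Data.List.Relation.Unary.Unique.Propositional using (Unique)
open import Data.List.Relation.Binary.Pointwise using (Pointwise; []; _∷_)
open import Data.List.Membership.Propositional using (_∈_)
open import Data.List.Membership.Propositional.Properties using (∈-map⁻; ∈-++⁻)
open import Data.Product using (∃; _×_; _,_)
open import Data.Sum using (_⊎_; inj₁; inj₂)
open import Relation.Nullary using (yes; no; ¬?; contradiction)
open import Relation.Unary using (Decidable)
open import Relation.Binary.PropositionalEquality using (_≡_; refl; cong)
open import Relation.Binary.Bundles using (Setoid)
import Relation.Binary.Reasoning.Setoid as SetoidReasoning

≐-setoid : Setoid _ _
≐-setoid = record
  { Carrier       = Expr
  ; _≈_           = _≐_
  ; isEquivalence = record { refl = ≐-refl ; sym = ≐-sym ; trans = ≐-trans }
  }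

open SetoidReasoning ≐-setoid

+-congˡ : ∀ {e f f'} → f ≐ f' → e + f ≐ e + f'
+-congˡ = +-cong ≐-refl

+-congʳ : ∀ {e e' f} → e ≐ e' → e + f ≐ e' + f
+-congʳ p = +-cong p ≐-refl

·-congˡ : ∀ {e f f'} → f ≐ f' → e · f ≐ e · f'
·-congˡ = ·-cong ≐-refl

·-congʳ : ∀ {e e' f} → e ≐ e' → e · f ≐ e' · f
·-congʳ p = ·-cong p ≐-refl

+-idʳ : ∀ e → e + 𝟘 ≐ e
+-idʳ e = ≐-trans (+-comm e 𝟘) (+-idˡ e)

≦-trans : ∀ {e f g} → e ≦ f → f ≦ g → e ≦ g
≦-trans {e} {f} {g} e≦f f≦g = begin
  e + g        ≈⟨ +-congˡ f≦g ⟨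
  e + (f + g)  ≈⟨ +-assoc e f g ⟨
  (e + f) + g  ≈⟨ +-congʳ e≦f ⟩
  f + g        ≈⟨ f≦g ⟩
  g            ∎

≦-antisym : ∀ {e f} → e ≦ f → f ≦ e → e ≐ f
≦-antisym {e} {f} e≦f f≦e = ≐-trans (≐-sym f≦e) (≐-trans (+-comm f e) e≦f)

≦-respˡ : ∀ {e e' f} → e ≐ e' → e' ≦ f → e ≦ f
≦-respˡ e≐e' e'≦f = ≐-trans (+-congʳ e≐e') e'≦f

≦-respʳ : ∀ {e f f'} → e ≦ f → f ≐ f' → e ≦ f'
≦-respʳ e≦f f≐f' = ≐-trans (+-congˡ (≐-sym f≐f')) (≐-trans e≦f f≐f')

x≦x+y : ∀ x y → x ≦ x + y
x≦x+y x y = ≐-trans (≐-sym (+-assoc x x y)) (+-congʳ (+-idem x))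

y≦x+y : ∀ x y → y ≦ x + y
y≦x+y x y = ≦-respʳ (x≦x+y y x) (+-comm y x)

·-monoˡ-≦ : ∀ {e f} g → e ≦ f → e · g ≦ f · g
·-monoˡ-≦ {e} {f} g e≦f = ≐-trans (≐-sym (distribʳ g e f)) (·-congʳ e≦f)

·-monoʳ-≦ : ∀ {e f} g → e ≦ f → g · e ≦ g · f
·-monoʳ-≦ {e} {f} g e≦f = ≐-trans (≐-sym (distribˡ g e f)) (·-congˡ e≦f)

≦𝟘⇒≐𝟘 : ∀ {e} → e ≦ 𝟘 → e ≐ 𝟘
≦𝟘⇒≐𝟘 {e} e≦𝟘 = ≐-trans (≐-sym (+-idʳ e)) e≦𝟘

≦𝟙⇒·-decreasingˡ : ∀ {u} g → u ≦ 𝟙 → u · g ≦ g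
≦𝟙⇒·-decreasingˡ g u≦𝟙 = ≦-respʳ (·-monoˡ-≦ g u≦𝟙) (·-idˡ g)

≦𝟙⇒·-decreasingʳ : ∀ {u} g → u ≦ 𝟙 → g · u ≦ g
≦𝟙⇒·-decreasingʳ g u≦𝟙 = ≦-respʳ (·-monoʳ-≦ g u≦𝟙) (·-idʳ g)

ad-compl² : ∀ x → x ⊥ + x ⊥ ⊥ ≐ 𝟙
ad-compl² x = ≐-trans (+-congˡ (≐-sym (dom-def x))) (ad-compl x)

ad≦𝟙 : ∀ x → x ⊥ ≦ 𝟙
ad≦𝟙 x = begin
  x ⊥ + 𝟙                  ≈⟨ +-congˡ (ad-compl² x) ⟨
  x ⊥ + (x ⊥ + x ⊥ ⊥)      ≈⟨ +-assoc _ _ _ ⟨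
  (x ⊥ + x ⊥) + x ⊥ ⊥      ≈⟨ +-congʳ (+-idem _) ⟩
  x ⊥ + x ⊥ ⊥              ≈⟨ ad-compl² x ⟩
  𝟙                        ∎

ad-𝟙 : 𝟙 ⊥ ≐ 𝟘
ad-𝟙 = ≐-trans (≐-sym (·-idʳ _)) (ad-annih 𝟙)

ad-𝟘 : 𝟘 ⊥ ≐ 𝟙
ad-𝟘 = begin
  𝟘 ⊥             ≈⟨ ⊥-cong ad-𝟙 ⟨
  𝟙 ⊥ ⊥           ≈⟨ +-idˡ _ ⟨
  𝟘 + 𝟙 ⊥ ⊥       ≈⟨ +-congʳ ad-𝟙 ⟨
  𝟙 ⊥ + 𝟙 ⊥ ⊥     ≈⟨ ad-compl² 𝟙 ⟩
  𝟙               ∎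

ad²-absorbˡ : ∀ z → z ≐ z ⊥ ⊥ · z
ad²-absorbˡ z = begin
  z                          ≈⟨ ·-idˡ z ⟨
  𝟙 · z                      ≈⟨ ·-congʳ (ad-compl² z) ⟨
  (z ⊥ + z ⊥ ⊥) · z          ≈⟨ distribʳ z _ _ ⟩
  z ⊥ · z + z ⊥ ⊥ · z        ≈⟨ +-congʳ (ad-annih z) ⟩
  𝟘 + z ⊥ ⊥ · z              ≈⟨ +-idˡ _ ⟩
  z ⊥ ⊥ · z                  ∎

ad²≐𝟘⇒≐𝟘 : ∀ {z} → z ⊥ ⊥ ≐ 𝟘 → z ≐ 𝟘
ad²≐𝟘⇒≐𝟘 {z} z⊥⊥≐𝟘 = ≐-trans (ad²-absorbˡ z) (≐-trans (·-congʳ z⊥⊥≐𝟘) (zeroˡ z))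

-- Locality is what lets y be replaced by its domain y ⊥ ⊥ behind u.
·≐𝟘⇒·ad²≐𝟘 : ∀ {u y} → u · y ≐ 𝟘 → u · y ⊥ ⊥ ≐ 𝟘
·≐𝟘⇒·ad²≐𝟘 {u} {y} uy≐𝟘 = ad²≐𝟘⇒≐𝟘 (begin
  (u · y ⊥ ⊥) ⊥ ⊥  ≈⟨ ⊥-cong (⊥-cong (·-congˡ (dom-def y))) ⟨
  (u · y ⊤) ⊥ ⊥    ≈⟨ ⊥-cong (ad-local u y) ⟨
  (u · y) ⊥ ⊥      ≈⟨ ⊥-cong (⊥-cong uy≐𝟘) ⟩
  𝟘 ⊥ ⊥            ≈⟨ ⊥-cong ad-𝟘 ⟩
  𝟙 ⊥              ≈⟨ ad-𝟙 ⟩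
  𝟘                ∎)

ad-annih² : ∀ x → x ⊥ · x ⊥ ⊥ ≐ 𝟘
ad-annih² x = ·≐𝟘⇒·ad²≐𝟘 (ad-annih x)

·≐𝟘⇒≐·ad : ∀ {u y} → u · y ≐ 𝟘 → u ≐ u · y ⊥
·≐𝟘⇒≐·ad {u} {y} uy≐𝟘 = begin
  u                            ≈⟨ ·-idʳ u ⟨
  u · 𝟙                        ≈⟨ ·-congˡ (ad-compl² y) ⟨
  u · (y ⊥ + y ⊥ ⊥)            ≈⟨ distribˡ u _ _ ⟩
  u · y ⊥ + u · y ⊥ ⊥          ≈⟨ +-congˡ (·≐𝟘⇒·ad²≐𝟘 uy≐𝟘) ⟩
  u · y ⊥ + 𝟘                  ≈⟨ +-idʳ _ ⟩
  u · y ⊥                      ∎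

·≐𝟘⇒≦ad : ∀ {u y} → u ≦ 𝟙 → u · y ≐ 𝟘 → u ≦ y ⊥
·≐𝟘⇒≦ad {u} {y} u≦𝟙 uy≐𝟘 =
  ≦-respˡ (·≐𝟘⇒≐·ad uy≐𝟘) (≦𝟙⇒·-decreasingˡ (y ⊥) u≦𝟙)

ad-idem : ∀ x → x ⊥ · x ⊥ ≐ x ⊥
ad-idem x = ≐-sym (·≐𝟘⇒≐·ad (ad-annih x))

ad-+ : ∀ x y → (x + y) ⊥ ≐ x ⊥ · y ⊥
ad-+ x y = ≦-antisym (≦-respˡ (≐-sym (ad-idem (x + y))) w·w≦u) u≦w
  where
  u w : Expr
  u = x ⊥ · y ⊥
  w = (x + y) ⊥

  u≦𝟙 : u ≦ 𝟙
  u≦𝟙 = ≦-trans (·-monoˡ-≦ (y ⊥) (ad≦𝟙 x)) (≦-respˡ (·-idˡ _) (ad≦𝟙 y))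

  ux≐𝟘 : u · x ≐ 𝟘
  ux≐𝟘 = ≦𝟘⇒≐𝟘 (≦-respʳ (·-monoˡ-≦ x (≦𝟙⇒·-decreasingʳ (x ⊥) (ad≦𝟙 y))) (ad-annih x))

  uy≐𝟘 : u · y ≐ 𝟘
  uy≐𝟘 = ≐-trans (·-assoc _ _ _) (≐-trans (·-congˡ (ad-annih y)) (zeroʳ _))

  u≦w : u ≦ w
  u≦w = ·≐𝟘⇒≦ad u≦𝟙 (≐-trans (distribˡ u x y) (≐-trans (+-cong ux≐𝟘 uy≐𝟘) (+-idˡ 𝟘)))

  w·≐𝟘 : ∀ {z} → z ≦ x + y → w · z ≐ 𝟘
  w·≐𝟘 z≦x+y = ≦𝟘⇒≐𝟘 (≦-respʳ (·-monoʳ-≦ w z≦x+y) (ad-annih _))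

  w·w≦u : w · w ≦ u
  w·w≦u = ≦-trans (·-monoˡ-≦ w (·≐𝟘⇒≦ad (ad≦𝟙 _) (w·≐𝟘 (x≦x+y x y))))
                  (·-monoʳ-≦ (x ⊥) (·≐𝟘⇒≦ad (ad≦𝟙 _) (w·≐𝟘 (y≦x+y x y))))

-- Up to ≐ the tests are exactly the antidomain elements; the Boolean algebra
-- of tests is developed in this form.
Test : Expr → Set
Test z = ∃ λ x → z ≐ x ⊥

Test-resp : ∀ {z z'} → z ≐ z' → Test z → Test z'
Test-resp z≐z' (x , z≐x⊥) = x , ≐-trans (≐-sym z≐z') z≐x⊥

Test-𝟙 : Test 𝟙
Test-𝟙 = 𝟘 , ≐-sym ad-𝟘

Test-⊥ : ∀ z → Test (z ⊥)
Test-⊥ z = z , ≐-refl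

Test-· : ∀ {z w} → Test z → Test w → Test (z · w)
Test-· (x , z≐x⊥) (y , w≐y⊥) = x + y , ≐-trans (·-cong z≐x⊥ w≐y⊥) (≐-sym (ad-+ x y))

Test⇒≦𝟙 : ∀ {z} → Test z → z ≦ 𝟙
Test⇒≦𝟙 (x , z≐x⊥) = ≦-respˡ z≐x⊥ (ad≦𝟙 x)

Test-comm : ∀ {z w} → Test z → Test w → z · w ≐ w · z
Test-comm {z} {w} (x , z≐x⊥) (y , w≐y⊥) = begin
  z · w         ≈⟨ ·-cong z≐x⊥ w≐y⊥ ⟩
  x ⊥ · y ⊥     ≈⟨ ad-+ x y ⟨
  (x + y) ⊥     ≈⟨ ⊥-cong (+-comm x y) ⟩
  (y + x) ⊥     ≈⟨ ad-+ y x ⟩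
  y ⊥ · x ⊥     ≈⟨ ·-cong w≐y⊥ z≐x⊥ ⟨
  w · z         ∎

Test-compl : ∀ {z} → Test z → z + z ⊥ ≐ 𝟙
Test-compl (x , z≐x⊥) = ≐-trans (+-cong z≐x⊥ (⊥-cong z≐x⊥)) (ad-compl² x)

Test-annih : ∀ {z} → Test z → z · z ⊥ ≐ 𝟘
Test-annih (x , z≐x⊥) = ≐-trans (·-cong z≐x⊥ (⊥-cong z≐x⊥)) (ad-annih² x)

≦-Test⇒≐·ʳ : ∀ {s t} → Test t → s ≦ t → s ≐ s · t
≦-Test⇒≐·ʳ {s} {t} Tt s≦t = begin
  s                     ≈⟨ ·-idʳ s ⟨
  s · 𝟙                 ≈⟨ ·-congˡ (Test-compl Tt) ⟨
  s · (t + t ⊥)         ≈⟨ distribˡ s _ _ ⟩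
  s · t + s · t ⊥       ≈⟨ +-congˡ (≦𝟘⇒≐𝟘 (≦-respʳ (·-monoˡ-≦ (t ⊥) s≦t) (Test-annih Tt))) ⟩
  s · t + 𝟘             ≈⟨ +-idʳ _ ⟩
  s · t                 ∎

Test-≦⇒·≐ : ∀ {φ G} → Test φ → Test G → G ≦ φ → φ · G ≐ G
Test-≦⇒·≐ Tφ TG G≦φ = ≐-trans (Test-comm Tφ TG) (≐-sym (≦-Test⇒≐·ʳ Tφ G≦φ))

Test-≦ad⇒·≐𝟘 : ∀ {φ G} → Test φ → Test G → G ≦ φ ⊥ → φ · G ≐ 𝟘
Test-≦ad⇒·≐𝟘 {φ} {G} Tφ TG G≦φ⊥ = begin
  φ · G               ≈⟨ ·-congˡ (Test-≦⇒·≐ (Test-⊥ φ) TG G≦φ⊥) ⟨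
  φ · (φ ⊥ · G)       ≈⟨ ·-assoc _ _ _ ⟨
  (φ · φ ⊥) · G       ≈⟨ ·-congʳ (Test-annih Tφ) ⟩
  𝟘 · G               ≈⟨ zeroˡ G ⟩
  𝟘                   ∎

IsParam⇒Test : ∀ {φ} → IsParam φ → Test φ
IsParam⇒Test (param-test (test {e} _)) = e ⊥ , dom-def e
IsParam⇒Test (param-prop p)            = prop p ⊥ , ≐-trans (≐-sym (prop-dom p)) (dom-def (prop p))

prod-∷ : ∀ φ l → prod (φ ∷ l) ≐ φ · prod l
prod-∷ φ []      = ≐-sym (·-idʳ φ)
prod-∷ φ (_ ∷ _) = ≐-refl

prod-Test : ∀ {l} → All Test l → Test (prod l)
prod-Test []               = Test-𝟙
prod-Test {φ ∷ l} (Tφ ∷ Tl) = Test-resp (≐-sym (prod-∷ φ l)) (Test-· Tφ (prod-Test Tl))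

prod-≦ : ∀ {l ψ} → All Test l → ψ ∈ l → prod l ≦ ψ
prod-≦ {φ ∷ l} (Tφ ∷ Tl) (here refl) =
  ≦-respˡ (prod-∷ φ l) (≦𝟙⇒·-decreasingʳ φ (Test⇒≦𝟙 (prod-Test Tl)))
prod-≦ {φ ∷ l} (Tφ ∷ Tl) (there ψ∈l) =
  ≦-respˡ (prod-∷ φ l) (≦-trans (≦𝟙⇒·-decreasingˡ _ (Test⇒≦𝟙 Tφ)) (prod-≦ Tl ψ∈l))

sum-++ : ∀ xs ys → sum (xs ++ ys) ≐ sum xs + sum ys
sum-++ []       ys = ≐-sym (+-idˡ _)
sum-++ (x ∷ xs) ys = ≐-trans (+-congˡ (sum-++ xs ys)) (≐-sym (+-assoc _ _ _))

sum-map-·ˡ : ∀ e xs → sum (map (e ·_) xs) ≐ e · sum xs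
sum-map-·ˡ e []       = ≐-sym (zeroʳ e)
sum-map-·ˡ e (x ∷ xs) = ≐-trans (+-congˡ (sum-map-·ˡ e xs)) (≐-sym (distribˡ e _ _))

sum-map-prod-∷ : ∀ φ L → sum (map prod (map (φ ∷_) L)) ≐ φ · sum (map prod L)
sum-map-prod-∷ φ []      = ≐-sym (zeroʳ φ)
sum-map-prod-∷ φ (l ∷ L) =
  ≐-trans (+-cong (prod-∷ φ l) (sum-map-prod-∷ φ L)) (≐-sym (distribˡ φ _ _))

sum-filter-≢𝟘 : (dec : Oracle) → ∀ xs → sum (filter (λ G → ¬? (dec G 𝟘)) xs) ≐ sum xs
sum-filter-≢𝟘 dec []       = ≐-refl
sum-filter-≢𝟘 dec (x ∷ xs) with dec x 𝟘
... | yes x≐𝟘 = begin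
  sum (filter (λ G → ¬? (dec G 𝟘)) xs)  ≈⟨ sum-filter-≢𝟘 dec xs ⟩
  sum xs                                ≈⟨ +-idˡ _ ⟨
  𝟘 + sum xs                            ≈⟨ +-congʳ x≐𝟘 ⟨
  x + sum xs                            ∎
... | no _    = +-congˡ (sum-filter-≢𝟘 dec xs)

sum-concatMap-sandwich : ∀ x C L →
  sum (concatMap (λ G → map (λ H → G · x · H) C) L) ≐ sum L · x · sum C
sum-concatMap-sandwich x C []      = ≐-sym (≐-trans (·-congʳ (zeroˡ x)) (zeroˡ (sum C)))
sum-concatMap-sandwich x C (G ∷ L) = begin
  sum (map (G · x ·_) C ++ rest)               ≈⟨ sum-++ (map (G · x ·_) C) rest ⟩
  sum (map (G · x ·_) C) + sum rest            ≈⟨ +-cong (sum-map-·ˡ (G · x) C)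
                                                         (sum-concatMap-sandwich x C L) ⟩
  G · x · sum C + sum L · x · sum C            ≈⟨ distribʳ _ _ _ ⟨
  (G · x + sum L · x) · sum C                  ≈⟨ ·-congʳ (distribʳ _ _ _) ⟨
  (G + sum L) · x · sum C                      ∎
  where
  rest : List Expr
  rest = concatMap (λ G → map (λ H → G · x · H) C) L

Decides : Expr → Expr → Set
Decides φ G = Test G × (G ≦ φ ⊎ G ≦ φ ⊥)

Test-·-sum≐sum-filter : ∀ {φ} → Test φ → (≦φ? : Decidable (_≦ φ)) →
  ∀ {xs} → All (Decides φ) xs → φ · sum xs ≐ sum (filter ≦φ? xs)
Test-·-sum≐sum-filter Tφ ≦φ? [] = zeroʳ _
Test-·-sum≐sum-filter {φ} Tφ ≦φ? {G ∷ xs} ((TG , G≦φ∨G≦φ⊥) ∷ ds)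
  with ≦φ? G | G≦φ∨G≦φ⊥
... | yes G≦φ | _         =
  ≐-trans (distribˡ φ G _) (+-cong (Test-≦⇒·≐ Tφ TG G≦φ) (Test-·-sum≐sum-filter Tφ ≦φ? ds))
... | no G≰φ  | inj₁ G≦φ  = contradiction G≦φ G≰φ
... | no _    | inj₂ G≦φ⊥ = begin
  φ · (G + sum xs)         ≈⟨ distribˡ φ G _ ⟩
  φ · G + φ · sum xs       ≈⟨ +-cong (Test-≦ad⇒·≐𝟘 Tφ TG G≦φ⊥) (Test-·-sum≐sum-filter Tφ ≦φ? ds) ⟩
  𝟘 + sum (filter ≦φ? xs)  ≈⟨ +-idˡ _ ⟩
  sum (filter ≦φ? xs)      ∎

Literal : Expr → Expr → Set
Literal φ ψ = ψ ≡ φ ⊎ ψ ≡ φ ⊥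

∈-atomLists⁻ : ∀ {Γ l} → l ∈ atomLists Γ → Pointwise Literal Γ l
∈-atomLists⁻ {[]}    (here refl) = []
∈-atomLists⁻ {φ ∷ Γ} l∈ with ∈-++⁻ (map (φ ∷_) (atomLists Γ)) l∈
... | inj₁ l∈₁ with ∈-map⁻ (φ ∷_) l∈₁
...   | _ , l'∈ , refl = inj₁ refl ∷ ∈-atomLists⁻ l'∈
∈-atomLists⁻ {φ ∷ Γ} l∈ | inj₂ l∈₂ with ∈-map⁻ (φ ⊥ ∷_) l∈₂
...   | _ , l'∈ , refl = inj₂ refl ∷ ∈-atomLists⁻ l'∈

literals-Test : ∀ {Γ l} → All Test Γ → Pointwise Literal Γ l → All Test l
literals-Test []        []                = []
literals-Test (Tφ ∷ TΓ) (inj₁ refl ∷ lits) = Tφ ∷ literals-Test TΓ lits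
literals-Test (_ ∷ TΓ)  (inj₂ refl ∷ lits) = Test-⊥ _ ∷ literals-Test TΓ lits

literals-∈ : ∀ {Γ l φ} → Pointwise Literal Γ l → φ ∈ Γ → φ ∈ l ⊎ φ ⊥ ∈ l
literals-∈ (inj₁ refl ∷ _)    (here refl) = inj₁ (here refl)
literals-∈ (inj₂ refl ∷ _)    (here refl) = inj₂ (here refl)
literals-∈ (_         ∷ lits) (there φ∈Γ) with literals-∈ lits φ∈Γ
... | inj₁ φ∈l  = inj₁ (there φ∈l)
... | inj₂ φ⊥∈l = inj₂ (there φ⊥∈l)

atom-Decides : ∀ {Γ l φ} → All Test Γ → l ∈ atomLists Γ → φ ∈ Γ → Decides φ (prod l)
atom-Decides TΓ l∈ φ∈Γ with ∈-atomLists⁻ l∈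
... | lits with literals-Test TΓ lits | literals-∈ lits φ∈Γ
...   | Tl | inj₁ φ∈l  = prod-Test Tl , inj₁ (prod-≦ Tl φ∈l)
...   | Tl | inj₂ φ⊥∈l = prod-Test Tl , inj₂ (prod-≦ Tl φ⊥∈l)

sum-atoms : ∀ {Γ} → All Test Γ → sum (atoms Γ) ≐ 𝟙
sum-atoms [] = +-idʳ 𝟙
sum-atoms {φ ∷ Γ} (Tφ ∷ TΓ) = begin
  sum (map prod (map (φ ∷_) L ++ map (φ ⊥ ∷_) L))
    ≡⟨ cong sum (map-++ prod (map (φ ∷_) L) _) ⟩
  sum (map prod (map (φ ∷_) L) ++ map prod (map (φ ⊥ ∷_) L))
    ≈⟨ sum-++ (map prod (map (φ ∷_) L)) _ ⟩
  sum (map prod (map (φ ∷_) L)) + sum (map prod (map (φ ⊥ ∷_) L))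
    ≈⟨ +-cong (sum-map-prod-∷ φ L) (sum-map-prod-∷ (φ ⊥) L) ⟩
  φ · sum (atoms Γ) + φ ⊥ · sum (atoms Γ)
    ≈⟨ distribʳ _ φ (φ ⊥) ⟨
  (φ + φ ⊥) · sum (atoms Γ)
    ≈⟨ ·-cong (Test-compl Tφ) (sum-atoms TΓ) ⟩
  𝟙 · 𝟙
    ≈⟨ ·-idˡ 𝟙 ⟩
  𝟙 ∎
  where
  L : List (List Expr)
  L = atomLists Γ

module _ (dec : Oracle) {Γ : List Expr} (TΓ : All Test Γ) where

  sum-consAtoms : sum (consAtoms dec Γ) ≐ 𝟙
  sum-consAtoms = ≐-trans (sum-filter-≢𝟘 dec (atoms Γ)) (sum-atoms TΓ)

  consAtoms-Decides : ∀ {φ} → φ ∈ Γ → All (Decides φ) (consAtoms dec Γ)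
  consAtoms-Decides φ∈Γ = filter⁺ _ (map⁺ (tabulate (λ l∈ → atom-Decides TΓ l∈ φ∈Γ)))

  ℂ-correct : ∀ {φ} → φ ∈ Γ → φ ≐ ℂ dec Γ φ
  ℂ-correct {φ} φ∈Γ = begin
    φ                        ≈⟨ ·-idʳ φ ⟨
    φ · 𝟙                    ≈⟨ ·-congˡ sum-consAtoms ⟨
    φ · sum (consAtoms dec Γ) ≈⟨ Test-·-sum≐sum-filter (All.lookup TΓ φ∈Γ)
                                   (λ G → dec (G + φ) φ) (consAtoms-Decides φ∈Γ) ⟩
    ℂ dec Γ φ                ∎

  ⟦⟧-correct : ∀ a → act a ≐ sum (⟦_⟧ dec Γ a)
  ⟦⟧-correct a = ≐-sym (begin
    sum (⟦_⟧ dec Γ a)              ≈⟨ sum-filter-≢𝟘 dec (strings dec Γ a) ⟩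
    sum (strings dec Γ a)          ≈⟨ sum-concatMap-sandwich (act a) C C ⟩
    sum C · act a · sum C          ≈⟨ ·-cong (·-congʳ sum-consAtoms) sum-consAtoms ⟩
    𝟙 · act a · 𝟙                  ≈⟨ ·-idʳ _ ⟩
    𝟙 · act a                      ≈⟨ ·-idˡ _ ⟩
    act a                          ∎)
    where
    C : List Expr
    C = consAtoms dec Γ

lemma5 : (dec : Oracle) (Γ : List Expr) → All IsParam Γ → Unique Γ →
           (e : RE Γ) → ⌜ e ⌝ ≐ hat dec Γ e
lemma5 dec Γ params _ = go
  where
  TΓ : All Test Γ
  TΓ = All.map IsParam⇒Test params

  go : (e : RE Γ) → ⌜ e ⌝ ≐ hat dec Γ e
  go (sym a)     = ⟦⟧-correct dec TΓ a
  go (par φ φ∈Γ) = ℂ-correct dec TΓ φ∈Γ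
  go 𝟘           = ≐-refl
  go 𝟙           = ≐-sym (sum-consAtoms dec TΓ)
  go (e + f)     = +-cong (go e) (go f)
  go (e · f)     = ·-cong (go e) (go f)
  go (e *)       = *-cong (go e)
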